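{- Let $\tau=B_1B_2\cdots B_b$ be the block decomposition of a primary irreducible type of width $k$, and set $s(i)=\mathbf{2}(B_1\cdots B_i)$ for $i\in[b]$. Let $X,Y\subseteq\mathbb{Q}$ be finite sets with $\tau(X,Y)=\tau$, and write $X=\{x_1<\dots<x_k\}$, $Y=\{y_1<\dots<y_k\}$. Then $x_{s(i+1)}<y_{s(i)+1}\le x_{s(i+1)+1}$ for all $i\in[b-2]$.
   Context: For finite sets $X,Y\subseteq\mathbb{Q}$ with $X\cup Y=\{z_1<\dots<z_\ell\}$, the order type $\tau(X,Y)$ is the sequence $(\tau_1,\dots,\tau_\ell)$ with $\tau_i=1$ if $z_i\in X\setminus Y$, $2$ if $z_i\in Y\setminus X$, $3$ if $z_i\in X\cap Y$. A type of width $k$ is the order type of a pair $(X,Y)$ with $|X|=|Y|=k$. A nonempty type is irreducible if it is not the concatenation of two nonempty types; primary if its first entry is $1$. For a finite sequence $B$ of ones, twos and threes, $\mathbf{1}(B)$ is the number of entries equal to $1$ or $3$ and $\mathbf{2}(B)$ the number equal to $2$ or $3$; juxtaposition denotes concatenation. Block decomposition of a primary irreducible type $\tau$: the first block $B_1$ consists of all initial ones of $\tau$; once $B_i$ is constructed, $B_{i+1}$ consists of the next consecutive entries of $\tau$ such that $\mathbf{2}(B_{i+1})=\mathbf{1}(B_i)$ and, subject to this, $B_{i+1}$ is as long as possible; stop when all entries are placed, giving $\tau=B_1\cdots B_b$. -}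

module Defs where

open import Data.Nat using (ℕ; zero; suc; _+_; _≤_)
open import Data.Fin as Fin using (Fin; toℕ)
open import Data.List using (List; []; _∷_; _++_; length; take; concat)
open import Data.List.Relation.Unary.All using (All)
open import Data.Vec as Vec using (Vec; lookup; toList)
open import Data.Rational as ℚ using (ℚ)
open import Data.Rational.Properties using (<-cmp)
open import Data.Product using (Σ; ∃; ∃-syntax; _×_; _,_)
open import Data.Empty using (⊥)
open import Relation.Binary.Definitions using (Tri; tri<; tri≈; tri>)
import Data.List
open import Relation.Binary.PropositionalEquality using (_≡_; _≢_)
open import Relation.Nullary using (¬_)

data Sym : Set where
  one two three : Sym

ones : List Sym → ℕ
ones []            = 0
ones (one   ∷ xs)  = suc (ones xs)
ones (two   ∷ xs)  = ones xs
ones (three ∷ xs)  = suc (ones xs)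

twos : List Sym → ℕ
twos []            = 0
twos (one   ∷ xs)  = twos xs
twos (two   ∷ xs)  = suc (twos xs)
twos (three ∷ xs)  = suc (twos xs)

-- a finite set {x_1 < ... < x_k} ⊆ ℚ, given by its increasing enumeration
StrictlyIncreasing : {k : ℕ} → Vec ℚ k → Set
StrictlyIncreasing {k} X = (i j : Fin k) → i Fin.< j → lookup X i ℚ.< lookup X j

-- order type of two sorted lists: merge them, recording membership
merge : List ℚ → List ℚ → List Sym
merge []       ys = Data.List.map (λ _ → two) ys
merge (x ∷ xs) ys = inner ys
  where
  rec : List ℚ → List Sym
  rec = merge xs
  choose : ∀ y → List ℚ → List Sym → Tri (x ℚ.< y) (x ≡ y) (y ℚ.< x) → List Sym
  choose y ys r (tri< _ _ _) = one   ∷ rec (y ∷ ys)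
  choose y ys r (tri≈ _ _ _) = three ∷ rec ys
  choose y ys r (tri> _ _ _) = two   ∷ r
  inner : List ℚ → List Sym
  inner []       = one ∷ rec []
  inner (y ∷ ys) = choose y ys (inner ys) (<-cmp x y)

orderType : {k m : ℕ} → Vec ℚ k → Vec ℚ m → List Sym
orderType X Y = merge (toList X) (toList Y)

IsTypeOfWidth : ℕ → List Sym → Set
IsTypeOfWidth k σ = Σ (Vec ℚ k) λ X → Σ (Vec ℚ k) λ Y →
  StrictlyIncreasing X × StrictlyIncreasing Y × orderType X Y ≡ σ

IsType : List Sym → Set
IsType σ = ∃[ k ] IsTypeOfWidth k σ

Irreducible : List Sym → Set
Irreducible τ = τ ≢ [] ×
  ¬ (Σ (List Sym) λ σ → Σ (List Sym) λ ρ →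
       IsType σ × IsType ρ × σ ≢ [] × ρ ≢ [] × τ ≡ σ ++ ρ)

Primary : List Sym → Set
Primary []      = ⊥
Primary (t ∷ _) = t ≡ one

-- "the next entries" after previous block P, starting from remainder R,
-- are cut into the blocks Bs following the construction; the construction
-- stops exactly when all entries are placed.
data BlocksAfter : List Sym → List Sym → List (List Sym) → Set where
  done : ∀ {P} → BlocksAfter P [] []
  step : ∀ {P r rs B R' Bs} →
         r ∷ rs ≡ B ++ R' →
         twos B ≡ ones P →
         -- B is as long as possible subject to 𝟐(B) = 𝟏(P)
         (∀ C D → r ∷ rs ≡ C ++ D → twos C ≡ ones P → length C ≤ length B) →
         BlocksAfter B R' Bs →
         BlocksAfter P (r ∷ rs) (B ∷ Bs)

-- the first block consists of all initial ones
HeadNotOne : List Sym → Set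
HeadNotOne []      = Data.Unit.⊤ where import Data.Unit
HeadNotOne (t ∷ _) = t ≢ one

BlockDecomposition : List Sym → List (List Sym) → Set
BlockDecomposition τ Bs =
  Σ (List Sym) λ B₁ → Σ (List Sym) λ R → Σ (List (List Sym)) λ Rest →
    Bs ≡ B₁ ∷ Rest × τ ≡ B₁ ++ R × All (_≡ one) B₁ × HeadNotOne R ×
    BlocksAfter B₁ R Rest

sFun : List (List Sym) → ℕ → ℕ
sFun Bs i = twos (concat (take i Bs))

-- Reading τ(X,Y) from left to right merges X and Y. After a prefix P of the type,
-- exactly 𝟏(P) elements of X and 𝟐(P) elements of Y have been read, and every x read
-- so far lies below every y still to come. Take P = B₁⋯B_i. The block equations
-- 𝟐(B_{j+1}) = 𝟏(B_j) and 𝟐(B₁) = 0 give 𝟏(P) = 𝟐(B₁⋯B_{i+1}) = s(i+1), while 𝟐(P) = s(i).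
-- Maximality of B_i makes the entry after P a 2 or a 3, so the next y is at most the
-- next x; and the next x exists because the nonempty block B_{i+2} starts with a 2 or 3,
-- whence 𝟏(B_{i+1}) = 𝟐(B_{i+2}) ≥ 1.
module Submission where

open import Defs
open import Data.Nat using (ℕ; zero; suc; _+_; _≤_; z≤n; s≤s) renaming (_<_ to _<ℕ_)
open import Data.Nat.Properties using (+-comm; +-identityʳ; m≤m+n; m<m+n; <-≤-trans; n≮n; module ≤-Reasoning)
open import Data.Fin using (Fin; toℕ; zero; suc)
open import Data.List using (List; []; _∷_; _++_; _∷ʳ_; length; take; concat; initLast; _∷ʳ′_)
open import Data.List.Properties using (∷-injectiveˡ; ∷-injectiveʳ; ++-assoc; length-++; ∷ʳ-++)
open import Data.List.Relation.Unary.All using (All; []; _∷_)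
import Data.List.Relation.Unary.All as All
open import Data.List.Relation.Unary.All.Properties using (++⁻ʳ; ∷ʳ⁻)
open import Data.List.Relation.Unary.AllPairs using (AllPairs; []; _∷_)
open import Data.Vec using (Vec; []; _∷_; lookup; toList)
open import Data.Vec.Relation.Unary.All.Properties using (lookup⁻; toList⁺)
open import Data.Rational using (ℚ; _<_) renaming (_≤_ to _≤ℚ_)
open import Data.Rational.Properties using (<-cmp; <-trans; <⇒≤; ≤-refl)
open import Data.Product using (Σ; ∃₂; _×_; _,_; proj₂)
open import Data.Unit using (tt)
open import Relation.Binary.Definitions using (tri<; tri≈; tri>)
open import Relation.Binary.PropositionalEquality using (_≡_; _≢_; refl; sym; trans; cong; cong₂; subst; module ≡-Reasoning)
open import Relation.Nullary using (contradiction)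

ones-++ : ∀ σ ρ → ones (σ ++ ρ) ≡ ones σ + ones ρ
ones-++ []          ρ = refl
ones-++ (one   ∷ σ) ρ = cong suc (ones-++ σ ρ)
ones-++ (two   ∷ σ) ρ = ones-++ σ ρ
ones-++ (three ∷ σ) ρ = cong suc (ones-++ σ ρ)

twos-++ : ∀ σ ρ → twos (σ ++ ρ) ≡ twos σ + twos ρ
twos-++ []          ρ = refl
twos-++ (one   ∷ σ) ρ = twos-++ σ ρ
twos-++ (two   ∷ σ) ρ = cong suc (twos-++ σ ρ)
twos-++ (three ∷ σ) ρ = cong suc (twos-++ σ ρ)

twos-∷ʳ-one : ∀ σ → twos (σ ∷ʳ one) ≡ twos σ
twos-∷ʳ-one σ = trans (twos-++ σ (one ∷ [])) (+-identityʳ (twos σ))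

twos-ones-++ : ∀ {σ} ρ → All (_≡ one) σ → twos (σ ++ ρ) ≡ twos ρ
twos-ones-++ ρ []           = refl
twos-ones-++ ρ (refl ∷ σ≡1) = twos-ones-++ ρ σ≡1

twos-pos : ∀ {t} σ → t ≢ one → 1 ≤ twos (t ∷ σ)
twos-pos {one}   σ t≢one = contradiction refl t≢one
twos-pos {two}   σ _     = s≤s z≤n
twos-pos {three} σ _     = s≤s z≤n

ones-merge-[] : ∀ ys → ones (merge [] ys) ≡ 0
ones-merge-[] []       = refl
ones-merge-[] (y ∷ ys) = ones-merge-[] ys

length-∷ʳ : ∀ {A : Set} (xs : List A) x → length (xs ∷ʳ x) ≡ suc (length xs)
length-∷ʳ xs x = trans (length-++ xs) (+-comm (length xs) 1)

Sorted : List ℚ → Set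
Sorted = AllPairs _<_

sorted-++⁻ʳ : ∀ xs {ys} → Sorted (xs ++ ys) → Sorted ys
sorted-++⁻ʳ []       s       = s
sorted-++⁻ʳ (x ∷ xs) (_ ∷ s) = sorted-++⁻ʳ xs s

toList-sorted : ∀ {k} {X : Vec ℚ k} → StrictlyIncreasing X → Sorted (toList X)
toList-sorted {X = []}    _  = []
toList-sorted {X = _ ∷ X} <X =
  toList⁺ (lookup⁻ (λ j → <X zero (suc j) (s≤s z≤n)))
  ∷ toList-sorted (λ i j i<j → <X (suc i) (suc j) (s≤s i<j))

data MergeHead : List ℚ → List ℚ → Sym → List Sym → Set where
  x-first : ∀ {x xs ys Q} → All (x <_) ys → merge xs ys ≡ Q → MergeHead (x ∷ xs) ys one Q
  common  : ∀ {x xs ys Q} → All (x <_) ys → merge xs ys ≡ Q → MergeHead (x ∷ xs) (x ∷ ys) three Q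
  y-first : ∀ {xs y ys Q} → All (y <_) xs → merge xs ys ≡ Q → MergeHead xs (y ∷ ys) two Q

data MergeCons (x : ℚ) (xs : List ℚ) (y : ℚ) (ys : List ℚ) : List Sym → Set where
  via-< : x < y → MergeCons x xs y ys (one ∷ merge xs (y ∷ ys))
  via-≡ : x ≡ y → MergeCons x xs y ys (three ∷ merge xs ys)
  via-> : y < x → MergeCons x xs y ys (two ∷ merge (x ∷ xs) ys)

merge-∷-∷ : ∀ x xs y ys → MergeCons x xs y ys (merge (x ∷ xs) (y ∷ ys))
merge-∷-∷ x xs y ys with <-cmp x y
... | tri< x<y _ _ = via-< x<y
... | tri≈ _ x≡y _ = via-≡ x≡y
... | tri> _ _ y<x = via-> y<x

merge-head : ∀ {xs ys t Q} → Sorted xs → Sorted ys → merge xs ys ≡ t ∷ Q → MergeHead xs ys t Q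
merge-head {[]}     {[]}     _ _ ()
merge-head {[]}     {_ ∷ _}  _ _ refl = y-first [] refl
merge-head {_ ∷ _}  {[]}     _ _ refl = x-first [] refl
merge-head {x ∷ xs} {y ∷ ys} _ _ eq with merge (x ∷ xs) (y ∷ ys) | merge-∷-∷ x xs y ys
merge-head (_ ∷ _) (y<ys ∷ _) refl | _ | via-< x<y = x-first (x<y ∷ All.map (<-trans x<y) y<ys) refl
merge-head (_ ∷ _) (y<ys ∷ _) refl | _ | via-≡ refl = common y<ys refl
merge-head (x<xs ∷ _) (_ ∷ _) refl | _ | via-> y<x = y-first (y<x ∷ All.map (<-trans y<x) x<xs) refl

record MergeSplit (P Q : List Sym) (xs ys : List ℚ) : Set where
  constructor split
  field
    xs₁ xs₂ ys₁ ys₂ : List ℚ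
    xs≡ : xs ≡ xs₁ ++ xs₂
    ys≡ : ys ≡ ys₁ ++ ys₂
    length-xs₁ : length xs₁ ≡ ones P
    length-ys₁ : length ys₁ ≡ twos P
    merge-rest : merge xs₂ ys₂ ≡ Q
    xs₁<ys₂ : All (λ x → All (x <_) ys₂) xs₁

merge-split : ∀ P {Q xs ys} → Sorted xs → Sorted ys → merge xs ys ≡ P ++ Q → MergeSplit P Q xs ys
merge-split []      {xs = xs} {ys} _ _ eq = split [] xs [] ys refl refl refl refl eq []
merge-split (t ∷ P) <xs <ys eq with merge-head <xs <ys eq
merge-split (one ∷ P) (_ ∷ <xs) <ys _ | x-first {x} x<ys rest
  with split xs₁ xs₂ ys₁ ys₂ refl refl |xs₁| |ys₁| rest′ sep ← merge-split P <xs <ys rest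
  = split (x ∷ xs₁) xs₂ ys₁ ys₂ refl refl (cong suc |xs₁|) |ys₁| rest′ (++⁻ʳ ys₁ x<ys ∷ sep)
merge-split (three ∷ P) (_ ∷ <xs) (_ ∷ <ys) _ | common {x} x<ys rest
  with split xs₁ xs₂ ys₁ ys₂ refl refl |xs₁| |ys₁| rest′ sep ← merge-split P <xs <ys rest
  = split (x ∷ xs₁) xs₂ (x ∷ ys₁) ys₂ refl refl (cong suc |xs₁|) (cong suc |ys₁|) rest′
      (++⁻ʳ ys₁ x<ys ∷ sep)
merge-split (two ∷ P) <xs (_ ∷ <ys) _ | y-first {y = y} _ rest
  with split xs₁ xs₂ ys₁ ys₂ refl refl |xs₁| |ys₁| rest′ sep ← merge-split P <xs <ys rest
  = split xs₁ xs₂ (y ∷ ys₁) ys₂ refl refl |xs₁| (cong suc |ys₁|) rest′ sep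

merge-heads-≤ : ∀ {xs ys t Q} → Sorted xs → Sorted ys → merge xs ys ≡ t ∷ Q → t ≢ one →
  1 ≤ ones (t ∷ Q) → ∃₂ λ w v → ∃₂ λ xs′ ys′ → xs ≡ w ∷ xs′ × ys ≡ v ∷ ys′ × v ≤ℚ w
merge-heads-≤ {[]} {ys} _ _ eq _ x-remains
  with () ← subst (1 ≤_) (trans (cong ones (sym eq)) (ones-merge-[] ys)) x-remains
merge-heads-≤ {w ∷ xs} <xs <ys eq t≢one _ with merge-head <xs <ys eq
... | x-first _ _           = contradiction refl t≢one
... | common {ys = ys} _ _  = w , w , xs , ys , refl , refl , ≤-refl
... | y-first (v<w ∷ _) _   = _ , _ , xs , _ , refl , refl , <⇒≤ v<w

record CutBeforeY (σ P : List Sym) : Set where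
  constructor cut
  field
    next : Sym
    rest : List Sym
    σ≡ : σ ≡ P ++ next ∷ rest
    next≢one : next ≢ one
    x-remains : 1 ≤ ones (next ∷ rest)

++-CutBeforeY : ∀ B {σ P} → CutBeforeY σ P → CutBeforeY (B ++ σ) (B ++ P)
++-CutBeforeY B {P = P} (cut t Q refl t≢one x-remains) =
  cut t Q (sym (++-assoc B P (t ∷ Q))) t≢one x-remains

merge-cut : ∀ P {t Q xs ys} → Sorted xs → Sorted ys → merge xs ys ≡ P ++ t ∷ Q → t ≢ one →
  1 ≤ ones (t ∷ Q) →
  ∃₂ λ xs₁ ys₁ → ∃₂ λ w v → ∃₂ λ xs₂ ys₂ →
    xs ≡ xs₁ ++ w ∷ xs₂ × ys ≡ ys₁ ++ v ∷ ys₂ ×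
    length xs₁ ≡ ones P × length ys₁ ≡ twos P × All (_< v) xs₁ × v ≤ℚ w
merge-cut P <xs <ys eq t≢one x-remains
  with split xs₁ _ ys₁ _ refl refl |xs₁| |ys₁| rest sep ← merge-split P <xs <ys eq
  with w , v , xs₂ , ys₂ , refl , refl , v≤w ←
         merge-heads-≤ (sorted-++⁻ʳ xs₁ <xs) (sorted-++⁻ʳ ys₁ <ys) rest t≢one x-remains
  = xs₁ , ys₁ , w , v , xs₂ , ys₂ , refl , refl , |xs₁| , |ys₁| , All.map All.head sep , v≤w

toList-++⇒lookup : ∀ {A : Set} {k} (X : Vec A k) l₁ {v l₂} → toList X ≡ l₁ ++ v ∷ l₂ →
  Σ (Fin k) λ a → toℕ a ≡ length l₁ × lookup X a ≡ v
toList-++⇒lookup (_ ∷ X) []       eq = zero , refl , ∷-injectiveˡ eq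
toList-++⇒lookup (_ ∷ X) (_ ∷ l₁) eq with a , a≡ , Xa≡ ← toList-++⇒lookup X l₁ (∷-injectiveʳ eq)
  = suc a , cong suc a≡ , Xa≡

cut-interlaces : ∀ {k P} (X Y : Vec ℚ k) → StrictlyIncreasing X → StrictlyIncreasing Y →
  CutBeforeY (orderType X Y) P → 1 ≤ ones P →
  Σ (Fin k) λ a → Σ (Fin k) λ b → Σ (Fin k) λ c →
    suc (toℕ a) ≡ ones P × suc (toℕ b) ≡ twos P + 1 × suc (toℕ c) ≡ ones P + 1 ×
    lookup X a < lookup Y b × lookup Y b ≤ℚ lookup X c
cut-interlaces {P = P} X Y <X <Y (cut t Q τ≡ t≢one x-remains) x∈P
  with merge-cut P (toList-sorted <X) (toList-sorted <Y) τ≡ t≢one x-remains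
... | xs₁ , ys₁ , w , v , xs₂ , ys₂ , X≡ , Y≡ , |xs₁| , |ys₁| , xs₁<v , v≤w with initLast xs₁
... | [] = contradiction (subst (1 ≤_) (sym |xs₁|) x∈P) λ ()
... | xs ∷ʳ′ u
  with a , a≡ , refl ← toList-++⇒lookup X xs (trans X≡ (∷ʳ-++ xs u (w ∷ xs₂)))
     | b , b≡ , refl ← toList-++⇒lookup Y ys₁ Y≡
     | c , c≡ , refl ← toList-++⇒lookup X (xs ∷ʳ u) X≡
  = a , b , c
  , trans (cong suc a≡) (trans (sym (length-∷ʳ xs u)) |xs₁|)
  , trans (+-comm 1 (toℕ b)) (cong (_+ 1) (trans b≡ |ys₁|))
  , trans (+-comm 1 (toℕ c)) (cong (_+ 1) (trans c≡ |xs₁|))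
  , proj₂ (∷ʳ⁻ xs₁<v) , v≤w

maximal⇒HeadNotOne : ∀ {P σ B R} → σ ≡ B ++ R → twos B ≡ ones P →
  (∀ C D → σ ≡ C ++ D → twos C ≡ ones P → length C ≤ length B) → HeadNotOne R
maximal⇒HeadNotOne {R = []}    _ _ _ = tt
maximal⇒HeadNotOne {B = B} {R = _ ∷ R} eq twos-B maximal refl =
  n≮n (length B) (subst (_≤ length B) (length-∷ʳ B one) longer)
  where
  longer : length (B ∷ʳ one) ≤ length B
  longer = maximal (B ∷ʳ one) R (trans eq (sym (∷ʳ-++ B one R))) (trans (twos-∷ʳ-one B) twos-B)

-- An empty block means 𝟏 of the previous block is 0, so by maximality the following
-- block is empty as well; the last block is nonempty since it covers a nonempty remainder.
blocks-nonempty : ∀ {P R Bs} → BlocksAfter P R Bs → All (_≢ []) Bs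
blocks-nonempty done = []
blocks-nonempty (step {B = _ ∷ _} _ _ _ rest) = (λ ()) ∷ blocks-nonempty rest
blocks-nonempty (step {B = []} () _ _ done)
blocks-nonempty (step {B = []} _ _ _ rest@(step {B = []} _ _ _ _))
  with B≢[] ∷ _ ← blocks-nonempty rest = contradiction refl B≢[]
blocks-nonempty (step {B = []} eq twos-B maximal (step {B = b ∷ B′} {R' = R′} eq′ twos-B′ _ _))
  with () ← maximal (b ∷ B′) R′ (trans eq eq′) (trans twos-B′ twos-B)

ones-pos-before-two-blocks : ∀ {P R B B′ Bs} → BlocksAfter P R (B ∷ B′ ∷ Bs) → 1 ≤ ones R
ones-pos-before-two-blocks (step _ _ _ rest@(step {B = []} _ _ _ _))
  with B′≢[] ∷ _ ← blocks-nonempty rest = contradiction refl B′≢[]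
ones-pos-before-two-blocks {P} {R}
  (step {B = B} {R' = R′} eq twos-B maximal (step {B = t ∷ B′} refl twos-B′ _ _)) = begin
    1                  ≤⟨ twos-pos B′ (maximal⇒HeadNotOne {P} eq twos-B maximal) ⟩
    twos (t ∷ B′)      ≡⟨ twos-B′ ⟩
    ones B             ≤⟨ m≤m+n (ones B) (ones R′) ⟩
    ones B + ones R′   ≡⟨ sym (ones-++ B R′) ⟩
    ones (B ++ R′)     ≡⟨ cong ones (sym eq) ⟩
    ones R             ∎
  where open ≤-Reasoning

cut-after-blocks : ∀ {P R Bs} → BlocksAfter P R Bs → HeadNotOne R →
  (j : ℕ) → j + 2 ≤ length Bs → CutBeforeY R (concat (take j Bs))
cut-after-blocks blocks@(step _ _ _ (step _ _ _ _)) t≢one zero _ =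
  cut _ _ refl t≢one (ones-pos-before-two-blocks blocks)
cut-after-blocks (step _ _ _ done) _ zero (s≤s ())
cut-after-blocks {P} (step {B = B} eq twos-B maximal rest) _ (suc j) (s≤s j+2≤) =
  subst (λ σ → CutBeforeY σ _) (sym eq)
    (++-CutBeforeY B (cut-after-blocks rest (maximal⇒HeadNotOne {P} eq twos-B maximal) j j+2≤))

twos-concat-take : ∀ {P R Bs} → BlocksAfter P R Bs → (n : ℕ) → n <ℕ length Bs →
  twos (concat (take (suc n) Bs)) ≡ ones P + ones (concat (take n Bs))
twos-concat-take (step {B = B} _ twos-B _ _) zero _ =
  trans (twos-++ B []) (cong (_+ 0) twos-B)
twos-concat-take {P} (step {B = B} {Bs = Bs} _ twos-B _ rest) (suc n) (s≤s n<) = begin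
  twos (B ++ concat (take (suc n) Bs))              ≡⟨ twos-++ B _ ⟩
  twos B + twos (concat (take (suc n) Bs))          ≡⟨ cong₂ _+_ twos-B (twos-concat-take rest n n<) ⟩
  ones P + (ones B + ones (concat (take n Bs)))     ≡⟨ cong (ones P +_) (sym (ones-++ B _)) ⟩
  ones P + ones (B ++ concat (take n Bs))           ∎
  where open ≡-Reasoning

s-suc≡ones-prefix : ∀ {τ Bs} → BlockDecomposition τ Bs → (i : ℕ) → i <ℕ length Bs →
  sFun Bs (suc i) ≡ ones (concat (take i Bs))
s-suc≡ones-prefix (B₁ , _ , _ , refl , _ , B₁≡1 , _ , _) zero _ = twos-ones-++ [] B₁≡1
s-suc≡ones-prefix (B₁ , _ , _ , refl , _ , B₁≡1 , _ , blocks) (suc j) (s≤s j<) =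
  trans (twos-ones-++ _ B₁≡1) (trans (twos-concat-take blocks j j<) (sym (ones-++ B₁ _)))

ones-prefix-pos : ∀ {τ Bs} → BlockDecomposition τ Bs → Primary τ →
  (i : ℕ) → 1 ≤ i → 1 ≤ ones (concat (take i Bs))
ones-prefix-pos (_ ∷ _ , _ , _ , refl , _ , refl ∷ _ , _ , _) _ (suc _) _ = s≤s z≤n
ones-prefix-pos ([] , []    , _ , refl , refl , _ , _ , _) () (suc _) _
ones-prefix-pos ([] , _ ∷ _ , _ , refl , refl , _ , t≢one , _) t≡one (suc _) _ =
  contradiction t≡one t≢one

cut-after-prefix : ∀ {τ Bs} → BlockDecomposition τ Bs →
  (i : ℕ) → 1 ≤ i → i + 2 ≤ length Bs → CutBeforeY τ (concat (take i Bs))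
cut-after-prefix (B₁ , _ , _ , refl , refl , _ , R-head , blocks) (suc j) _ (s≤s j+2≤) =
  ++-CutBeforeY B₁ (cut-after-blocks blocks R-head j j+2≤)

lemma2p3 : (k : ℕ) (τ : List Sym) (Bs : List (List Sym)) →
    IsTypeOfWidth k τ → Primary τ → Irreducible τ → BlockDecomposition τ Bs →
    (X Y : Vec ℚ k) → StrictlyIncreasing X → StrictlyIncreasing Y →
    orderType X Y ≡ τ →
    (i : ℕ) → 1 ≤ i → i + 2 ≤ length Bs →
    Σ (Fin k) λ a → Σ (Fin k) λ b → Σ (Fin k) λ c →
      suc (toℕ a) ≡ sFun Bs (suc i) × suc (toℕ b) ≡ sFun Bs i + 1 ×
      suc (toℕ c) ≡ sFun Bs (suc i) + 1 ×
      lookup X a < lookup Y b × lookup Y b ≤ℚ lookup X c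
lemma2p3 k τ Bs _ primary _ blocks X Y <X <Y refl i 1≤i i+2≤b
  with a , b , c , a≡ , b≡ , c≡ , Xa<Yb , Yb≤Xc ←
         cut-interlaces X Y <X <Y (cut-after-prefix blocks i 1≤i i+2≤b)
                        (ones-prefix-pos blocks primary i 1≤i)
  = a , b , c , trans a≡ s≡ , b≡ , trans c≡ (cong (_+ 1) s≡) , Xa<Yb , Yb≤Xc
  where
  s≡ : ones (concat (take i Bs)) ≡ sFun Bs (suc i)
  s≡ = sym (s-suc≡ones-prefix blocks i (<-≤-trans (m<m+n i (s≤s z≤n)) i+2≤b))
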